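{- (i) If two almost-sub-STS$(9)$ of the same Steiner triple system have different supports, then these supports intersect in at most $3$ points. (ii) If two almost-sub-STS$(9)$ of the same Steiner triple system of order $21$ have different supports, then these supports intersect in exactly $3$ points, and these $3$ points form either a block of each of the two almost-sub-STS$(9)$, or the missing triple of one or both of them.
   Context: A Steiner triple system STS$(v)$ on a $v$-set $S$ is a collection of 3-subsets (blocks) of $S$ such that every two distinct points lie in exactly one block. A subset $\mathcal C$ of an STS $\mathcal B$ is an almost-sub-STS$(9)$ if $\mathcal C=\mathcal C'\setminus\{T\}$ for some STS$(9)$ $\mathcal C'$ on a 9-point set (the support of $\mathcal C$) and some triple $T\in\mathcal C'$, called the missing triple ($T$ need not be a block of $\mathcal B$). -}

module Defs where

open import Data.Nat using (ℕ)
open import Data.Fin using (Fin)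
open import Data.Fin.Subset using (Subset; _∈_; _⊆_; ∣_∣; ⊤)
open import Data.Product using (Σ; ∃; _×_)
open import Relation.Binary.PropositionalEquality using (_≡_; _≢_)

Collection : ℕ → Set₁
Collection v = Subset v → Set

record IsSTSOn {v : ℕ} (D : Subset v) (B : Collection v) : Set where
  field
    block-⊆    : ∀ b → B b → b ⊆ D
    block-size : ∀ b → B b → ∣ b ∣ ≡ 3
    covers     : ∀ x y → x ∈ D → y ∈ D → x ≢ y →
                 Σ (Subset v) λ b → B b × x ∈ b × y ∈ b
    unique     : ∀ x y → x ≢ y → ∀ b b' → B b → B b' →
                 x ∈ b → y ∈ b → x ∈ b' → y ∈ b' → b ≡ b'

IsSTS : (v : ℕ) → Collection v → Set
IsSTS v B = IsSTSOn ⊤ B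

Remove : {v : ℕ} → Collection v → Subset v → Collection v
Remove C' T b = C' b × b ≢ T

-- The almost-sub-STS(9)  C = C' \ {T}  of B, with support D and missing
-- triple T: C' is an STS(9) on the 9-point set D, T is a block of C',
-- and C' \ {T} ⊆ B  (T itself need not be a block of B).
record AlmostSubSTS9 {v : ℕ} (B : Collection v)
                     (D : Subset v) (C' : Collection v) (T : Subset v) : Set where
  field
    support-size : ∣ D ∣ ≡ 9
    isSTS9       : IsSTSOn D C'
    missing∈     : C' T
    sub          : ∀ b → Remove C' T b → B b

module Submission where

-- Write I = D₁ ∩ D₂. A pair of points of I lying neither both in T₁ nor both in T₂ spans a
-- C₁-block and a C₂-block that are both blocks of B, hence equal: the pair lies on a "full" line,
-- which is contained in I.
-- (i) If 4 ≤ |I| ≤ 5, take a full line F and a point w ∈ I off F; a case analysis of how the pairs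
-- from w to F are covered always produces three full lines forming a triangle, i.e. six points of I.
-- If |I| ≥ 6 then |D₁ ∖ D₂| ≤ 3. But a C₁-block through u ∈ D₁ ∖ D₂ other than T₁ either has its two
-- other points in T₂, which happens for at most one such block, or meets D₁ ∖ D₂ again; taking u ∉ T₁,
-- the four C₁-blocks through u give |D₁ ∖ D₂| ≥ 4, so D₁ ∖ D₂ = ∅ and D₁ = D₂.
-- (ii) For r ∉ D₁ and each of the ≥ 6 points d ∈ D₁ ∖ T₁, the third point of the B-block {r, d, ·}
-- lies outside D₁. Hence three B-blocks through r missing D₁ force |∁D₁| ≥ 3·2 + 1 + 6 = 13 > 12.
-- If |I| ≤ 2 there is w ∈ D₂ ∖ D₁ and a C₂-block through w containing I whose three companions
-- through w are not T₂; they are such B-blocks. If |I| = 3, either a pair of I spans a full line,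
-- which is then I, or two pairs lie in the same Tᵢ and I = Tᵢ.

open import Defs
open import Data.Nat using (ℕ; zero; suc; _≤_; _<_; z≤n; s≤s; _+_; _*_; _∸_)
open import Data.Nat.Properties
  using (module ≤-Reasoning; _≟_; _≤?_; ≤-refl; ≤-reflexive; ≤-trans; ≤-pred; m≤n⇒m≤1+n; ≤∧≢⇒<; ≰⇒>;
         <⇒≱; 1+n≰n; +-suc; m+n∸m≡n; ∸-mono; ∸-monoʳ-≤)
open import Data.Fin using (Fin; zero; suc)
open import Data.Fin.Properties using () renaming (_≟_ to _≟ᶠ_)
open import Data.Vec using ([]; _∷_; here; there)
open import Data.Fin.Subset
  using (Subset; inside; outside; _∈_; _∉_; _⊆_; _∩_; ∁; ∣_∣)
open import Data.Fin.Subset.Properties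
  using (drop-∷-⊆; p⊆q⇒∣p∣≤∣q∣; ∣∁p∣≡n∸∣p∣; _∈?_; nonempty?; ∈⊤; x∈p∩q⁺; x∈p∩q⁻; x∈∁p⇒x∉p; x∉p⇒x∈∁p; ∣p∩q∣≤∣q∣)
open import Data.List using (List; []; _∷_; length; map; _++_)
open import Data.List.Relation.Unary.All as All using (All; []; _∷_)
open import Data.List.Relation.Unary.Any using (Any; here; there; any?)
open import Data.List.Relation.Unary.AllPairs using (AllPairs; []; _∷_)
open import Data.List.Relation.Unary.AllPairs.Properties using (++⁺)
open import Data.List.Properties using (length-++; length-map)
import Data.List.Relation.Unary.All.Properties as All
open import Data.Product using (∃; ∃-syntax; _×_; _,_; proj₁; proj₂)
open import Data.Sum using (_⊎_; inj₁; inj₂; [_,_]′)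
open import Data.Empty using (⊥; ⊥-elim)
open import Relation.Nullary using (¬_; yes; no)
open import Relation.Nullary.Decidable using (_×-dec_)
open import Relation.Binary.PropositionalEquality
  using (_≡_; _≢_; refl; sym; trans; cong; cong₂; subst; ≢-sym; module ≡-Reasoning)
open import Function using (id; _∘_; flip)

-- Counting in finite subsets

remove : ∀ {n} → Fin n → Subset n → Subset n
remove zero    (_ ∷ p) = outside ∷ p
remove (suc x) (s ∷ p) = s ∷ remove x p

∈-remove⁺ : ∀ {n} {p : Subset n} {x y} → y ∈ p → y ≢ x → y ∈ remove x p
∈-remove⁺ {x = zero}  here         y≢x = ⊥-elim (y≢x refl)
∈-remove⁺ {x = zero}  (there y∈p)  _   = there y∈p
∈-remove⁺ {x = suc x} here         _   = here
∈-remove⁺ {x = suc x} (there y∈p)  y≢x = there (∈-remove⁺ y∈p (λ y≡x → y≢x (cong suc y≡x)))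

∈-remove⁻ : ∀ {n} {p : Subset n} {x y} → y ∈ remove x p → y ∈ p × y ≢ x
∈-remove⁻ {p = _ ∷ _} {zero}  {suc y} (there y∈p) = there y∈p , λ ()
∈-remove⁻ {p = _ ∷ _} {suc x} {zero}  here        = here , λ ()
∈-remove⁻ {p = _ ∷ _} {suc x} {suc y} (there y∈) =
  let y∈p , y≢x = ∈-remove⁻ y∈ in there y∈p , λ { refl → y≢x refl }

∣remove∣<∣p∣ : ∀ {n} {p : Subset n} {x} → x ∈ p → ∣ remove x p ∣ < ∣ p ∣
∣remove∣<∣p∣ {p = inside ∷ p}  here        = ≤-refl
∣remove∣<∣p∣ {p = inside ∷ p}  (there x∈p) = s≤s (∣remove∣<∣p∣ x∈p)
∣remove∣<∣p∣ {p = outside ∷ p} (there x∈p) = ∣remove∣<∣p∣ x∈p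

∣p∣≤1+∣remove∣ : ∀ {n} (p : Subset n) x → ∣ p ∣ ≤ suc ∣ remove x p ∣
∣p∣≤1+∣remove∣ (inside ∷ p)  zero    = ≤-refl
∣p∣≤1+∣remove∣ (outside ∷ p) zero    = m≤n⇒m≤1+n ≤-refl
∣p∣≤1+∣remove∣ (inside ∷ p)  (suc x) = s≤s (∣p∣≤1+∣remove∣ p x)
∣p∣≤1+∣remove∣ (outside ∷ p) (suc x) = ∣p∣≤1+∣remove∣ p x

length≤∣S∣ : ∀ {n} {S : Subset n} {xs} → AllPairs _≢_ xs → All (_∈ S) xs → length xs ≤ ∣ S ∣
length≤∣S∣ [] [] = z≤n
length≤∣S∣ (x≢xs ∷ distinct) (x∈S ∷ xs⊆S) =
  ≤-trans (s≤s (length≤∣S∣ distinct xs⊆S-x)) (∣remove∣<∣p∣ x∈S)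
  where
  xs⊆S-x = All.zipWith (λ (x≢y , y∈S) → ∈-remove⁺ y∈S (≢-sym x≢y)) (x≢xs , xs⊆S)

fresh : ∀ {n} (S : Subset n) xs → length xs < ∣ S ∣ → ∃[ y ] y ∈ S × All (y ≢_) xs
fresh (inside ∷ S) [] _ = zero , here , []
fresh (outside ∷ S) [] 0<∣S∣ with fresh S [] 0<∣S∣
... | y , y∈S , [] = suc y , there y∈S , []
fresh S (x ∷ xs) ∣x∷xs∣<∣S∣
  with fresh (remove x S) xs (≤-pred (≤-trans ∣x∷xs∣<∣S∣ (∣p∣≤1+∣remove∣ S x)))
... | y , y∈S-x , y≢xs = let y∈S , y≢x = ∈-remove⁻ y∈S-x in y , y∈S , y≢x ∷ y≢xs

distinct-elements : ∀ {n} (S : Subset n) k → k ≤ ∣ S ∣ →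
                    ∃[ xs ] length xs ≡ k × AllPairs _≢_ xs × All (_∈ S) xs
distinct-elements S zero    _     = [] , refl , [] , []
distinct-elements S (suc k) k<∣S∣ with distinct-elements S k (≤-trans (m≤n⇒m≤1+n ≤-refl) k<∣S∣)
... | xs , refl , distinct , xs⊆S with fresh S xs k<∣S∣
... | y , y∈S , y≢xs = y ∷ xs , refl , y≢xs ∷ distinct , y∈S ∷ xs⊆S

∣S∣≤length⇒∈ : ∀ {n} {S : Subset n} {xs y} → AllPairs _≢_ xs → All (_∈ S) xs →
               ∣ S ∣ ≤ length xs → y ∈ S → Any (y ≡_) xs
∣S∣≤length⇒∈ {xs = xs} {y} distinct xs⊆S ∣S∣≤∣xs∣ y∈S with any? (y ≟ᶠ_) xs
... | yes y∈xs = y∈xs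
... | no  y∉xs = ⊥-elim (<⇒≱ (length≤∣S∣ (All.¬Any⇒All¬ xs y∉xs ∷ distinct) (y∈S ∷ xs⊆S)) ∣S∣≤∣xs∣)

∈-pair : ∀ {n} {S : Subset n} {a b x} → a ≢ b → a ∈ S → b ∈ S → ∣ S ∣ ≤ 2 → x ∈ S → x ≡ a ⊎ x ≡ b
∈-pair a≢b a∈S b∈S ∣S∣≤2 x∈S with ∣S∣≤length⇒∈ ((a≢b ∷ []) ∷ [] ∷ []) (a∈S ∷ b∈S ∷ []) ∣S∣≤2 x∈S
... | here x≡a         = inj₁ x≡a
... | there (here x≡b) = inj₂ x≡b

∣p∩q∣+∣p∩∁q∣≡∣p∣ : ∀ {n} (p q : Subset n) → ∣ p ∩ q ∣ + ∣ p ∩ ∁ q ∣ ≡ ∣ p ∣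
∣p∩q∣+∣p∩∁q∣≡∣p∣ []            []            = refl
∣p∩q∣+∣p∩∁q∣≡∣p∣ (inside ∷ p)  (inside ∷ q)  = cong suc (∣p∩q∣+∣p∩∁q∣≡∣p∣ p q)
∣p∩q∣+∣p∩∁q∣≡∣p∣ (inside ∷ p)  (outside ∷ q) = trans (+-suc _ _) (cong suc (∣p∩q∣+∣p∩∁q∣≡∣p∣ p q))
∣p∩q∣+∣p∩∁q∣≡∣p∣ (outside ∷ p) (inside ∷ q)  = ∣p∩q∣+∣p∩∁q∣≡∣p∣ p q
∣p∩q∣+∣p∩∁q∣≡∣p∣ (outside ∷ p) (outside ∷ q) = ∣p∩q∣+∣p∩∁q∣≡∣p∣ p q

∣p∩∁q∣≡∣p∣∸∣p∩q∣ : ∀ {n} (p q : Subset n) → ∣ p ∩ ∁ q ∣ ≡ ∣ p ∣ ∸ ∣ p ∩ q ∣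
∣p∩∁q∣≡∣p∣∸∣p∩q∣ p q = trans (sym (m+n∸m≡n ∣ p ∩ q ∣ _)) (cong (_∸ ∣ p ∩ q ∣) (∣p∩q∣+∣p∩∁q∣≡∣p∣ p q))

∉⇒≢ : ∀ {n} {b : Subset n} {w x} → w ∉ b → x ∈ b → w ≢ x
∉⇒≢ w∉b x∈b refl = w∉b x∈b

≢-if-¬both : ∀ {n} {b b' : Subset n} {x y} → x ∈ b → y ∈ b → ¬ (x ∈ b' × y ∈ b') → b ≢ b'
≢-if-¬both x∈b y∈b ¬both refl = ¬both (x∈b , y∈b)

⊆∧∣∣≥⇒≡ : ∀ {n} {p q : Subset n} → p ⊆ q → ∣ q ∣ ≤ ∣ p ∣ → p ≡ q
⊆∧∣∣≥⇒≡ {p = []}          {[]}          _   _   = refl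
⊆∧∣∣≥⇒≡ {p = inside ∷ p}  {inside ∷ q}  p⊆q q≤p = cong (inside ∷_) (⊆∧∣∣≥⇒≡ (drop-∷-⊆ p⊆q) (≤-pred q≤p))
⊆∧∣∣≥⇒≡ {p = inside ∷ p}  {outside ∷ q} p⊆q _   with p⊆q here
... | ()
⊆∧∣∣≥⇒≡ {p = outside ∷ p} {inside ∷ q}  p⊆q q<p = ⊥-elim (<⇒≱ q<p (p⊆q⇒∣p∣≤∣q∣ (drop-∷-⊆ p⊆q)))
⊆∧∣∣≥⇒≡ {p = outside ∷ p} {outside ∷ q} p⊆q q≤p = cong (outside ∷_) (⊆∧∣∣≥⇒≡ (drop-∷-⊆ p⊆q) q≤p)

AllPairs-map-on : ∀ {A B : Set} {P : A → Set} {R : A → A → Set} {R' : B → B → Set} (f : A → B) →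
                  (∀ {x y} → P x → P y → R x y → R' (f x) (f y)) →
                  ∀ {xs} → All P xs → AllPairs R xs → AllPairs R' (map f xs)
AllPairs-map-on f g [] [] = []
AllPairs-map-on {P = P} {R} {R'} f g (px ∷ pxs) (Rx ∷ Rxs) = head pxs Rx ∷ AllPairs-map-on f g pxs Rxs
  where
  head : ∀ {ys} → All P ys → All (R _) ys → All (R' (f _)) (map f ys)
  head [] [] = []
  head (py ∷ pys) (r ∷ rs) = g px py r ∷ head pys rs

module Triple {n} {b : Subset n} (∣b∣≡3 : ∣ b ∣ ≡ 3) where

  third : ∀ x y → ∃[ z ] z ∈ b × z ≢ x × z ≢ y
  third x y with fresh b (x ∷ y ∷ []) (≤-reflexive (sym ∣b∣≡3))
  ... | z , z∈b , z≢x ∷ z≢y ∷ [] = z , z∈b , z≢x , z≢y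

  no-four : ∀ {x y z w} → AllPairs _≢_ (x ∷ y ∷ z ∷ w ∷ []) → All (_∈ b) (x ∷ y ∷ z ∷ w ∷ []) → ⊥
  no-four distinct xs⊆b = 1+n≰n (subst (4 ≤_) ∣b∣≡3 (length≤∣S∣ distinct xs⊆b))

  ∈-cases : ∀ {x y z w} → x ≢ y → x ≢ z → y ≢ z → x ∈ b → y ∈ b → z ∈ b → w ∈ b →
            w ≡ x ⊎ w ≡ y ⊎ w ≡ z
  ∈-cases x≢y x≢z y≢z x∈b y∈b z∈b w∈b
    with ∣S∣≤length⇒∈ ((x≢y ∷ x≢z ∷ []) ∷ (y≢z ∷ []) ∷ [] ∷ []) (x∈b ∷ y∈b ∷ z∈b ∷ [])
                      (≤-reflexive ∣b∣≡3) w∈b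
  ... | here w≡x = inj₁ w≡x
  ... | there (here w≡y) = inj₂ (inj₁ w≡y)
  ... | there (there (here w≡z)) = inj₂ (inj₂ w≡z)

  ≡-if-three-common : ∀ {b' x y z} → ∣ b' ∣ ≤ 3 → x ≢ y → x ≢ z → y ≢ z →
                      x ∈ b → y ∈ b → z ∈ b → x ∈ b' → y ∈ b' → z ∈ b' → b ≡ b'
  ≡-if-three-common ∣b'∣≤3 x≢y x≢z y≢z x∈b y∈b z∈b x∈b' y∈b' z∈b' =
    ⊆∧∣∣≥⇒≡ b⊆b' (subst (_ ≤_) (sym ∣b∣≡3) ∣b'∣≤3)
    where
    b⊆b' : b ⊆ _
    b⊆b' w∈b with ∈-cases x≢y x≢z y≢z x∈b y∈b z∈b w∈b
    ... | inj₁ refl = x∈b'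
    ... | inj₂ (inj₁ refl) = y∈b'
    ... | inj₂ (inj₂ refl) = z∈b'

-- Steiner triple systems

module Steiner {v} {D : Subset v} {C : Collection v} (S : IsSTSOn D C) where
  open IsSTSOn S public

  same-block : ∀ {x y b b'} → x ≢ y → C b → C b' → x ∈ b → y ∈ b → x ∈ b' → y ∈ b' → b ≡ b'
  same-block x≢y = unique _ _ x≢y _ _

  apart : ∀ {u a c b b'} → C b → C b' → b ≢ b' → u ∈ b → u ∈ b' → a ∈ b → c ∈ b' → a ≢ u → a ≢ c
  apart b∈C b'∈C b≢b' u∈b u∈b' a∈b a∈b' a≢u refl =
    b≢b' (same-block (≢-sym a≢u) b∈C b'∈C u∈b a∈b u∈b' a∈b')

  record Line (x y : Fin v) : Set where
    field
      block   : Subset v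
      ∈C      : C block
      third   : Fin v
      x∈      : x ∈ block
      y∈      : y ∈ block
      third∈  : third ∈ block
      x≢y     : x ≢ y
      x≢third : x ≢ third
      y≢third : y ≢ third

    ⊆D : block ⊆ D
    ⊆D = block-⊆ block ∈C

    x∈D : x ∈ D
    x∈D = ⊆D x∈

    ∈-cases : ∀ {w} → w ∈ block → w ≡ x ⊎ w ≡ y ⊎ w ≡ third
    ∈-cases = Triple.∈-cases (block-size block ∈C) x≢y x≢third y≢third x∈ y∈ third∈

    ∉block : ∀ {w} → w ≢ x → w ≢ y → w ≢ third → w ∉ block
    ∉block w≢x w≢y w≢z w∈ with ∈-cases w∈
    ... | inj₁ w≡x = w≢x w≡x
    ... | inj₂ (inj₁ w≡y) = w≢y w≡y
    ... | inj₂ (inj₂ w≡z) = w≢z w≡z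

  open Line using (block; ∈C; third; x∈; y∈; third∈; x≢third; y≢third)

  block→Line : ∀ {b x y} → C b → x ∈ b → y ∈ b → x ≢ y → Line x y
  block→Line {b} {x} {y} b∈C x∈b y∈b x≢y =
    let z , z∈b , z≢x , z≢y = Triple.third (block-size b b∈C) x y in
    record { block = b ; ∈C = b∈C ; third = z ; x∈ = x∈b ; y∈ = y∈b ; third∈ = z∈b
           ; x≢y = x≢y ; x≢third = ≢-sym z≢x ; y≢third = ≢-sym z≢y }

  line : ∀ {x y} → x ∈ D → y ∈ D → x ≢ y → Line x y
  line x∈D y∈D x≢y =
    let b , b∈C , x∈b , y∈b = covers _ _ x∈D y∈D x≢y in block→Line b∈C x∈b y∈b x≢y

  third-unique : ∀ {x y} (ℓ ℓ' : Line x y) → third ℓ ≡ third ℓ'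
  third-unique ℓ ℓ' with Line.∈-cases ℓ' (subst (third ℓ ∈_) ℓ≡ℓ' (third∈ ℓ))
    where ℓ≡ℓ' = same-block (Line.x≢y ℓ) (∈C ℓ) (∈C ℓ') (x∈ ℓ) (y∈ ℓ) (x∈ ℓ') (y∈ ℓ')
  ... | inj₁ z≡x         = ⊥-elim (x≢third ℓ (sym z≡x))
  ... | inj₂ (inj₁ z≡y)  = ⊥-elim (y≢third ℓ (sym z≡y))
  ... | inj₂ (inj₂ z≡z') = z≡z'

  line-avoiding : ∀ {u} → u ∈ D → ∀ ps → suc (length ps) < ∣ D ∣ → ∃[ p ] Line u p × All (p ≢_) ps
  line-avoiding u∈D ps ∣u∷ps∣<∣D∣ with fresh D (_ ∷ ps) ∣u∷ps∣<∣D∣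
  ... | p , p∈D , p≢u ∷ p≢ps = p , line u∈D p∈D (≢-sym p≢u) , p≢ps

  new-block : ∀ {u p p'} (ℓ : Line u p) (ℓ' : Line u p') → p' ≢ p → p' ≢ third ℓ → block ℓ ≢ block ℓ'
  new-block ℓ ℓ' p'≢p p'≢z ℓ≡ℓ' =
    Line.∉block ℓ (≢-sym (Line.x≢y ℓ')) p'≢p p'≢z (subst (_ ∈_) (sym ℓ≡ℓ') (y∈ ℓ'))

  record Pencil {u p₁} (ℓ₁ : Line u p₁) : Set where
    field
      {p₂ p₃ p₄} : Fin v
      ℓ₂ : Line u p₂
      ℓ₃ : Line u p₃
      ℓ₄ : Line u p₄
      distinct : AllPairs _≢_ (block ℓ₁ ∷ block ℓ₂ ∷ block ℓ₃ ∷ block ℓ₄ ∷ [])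

  pencil : 8 ≤ ∣ D ∣ → ∀ {u p₁} (ℓ₁ : Line u p₁) → Pencil ℓ₁
  pencil 8≤∣D∣ {u} {p₁} ℓ₁
    with line-avoiding (Line.x∈D ℓ₁) (p₁ ∷ third ℓ₁ ∷ []) (≤-trans (s≤s (s≤s (s≤s (s≤s z≤n)))) 8≤∣D∣)
  ... | p₂ , ℓ₂ , p₂≢p₁ ∷ p₂≢z₁ ∷ []
    with line-avoiding (Line.x∈D ℓ₁) (p₁ ∷ third ℓ₁ ∷ p₂ ∷ third ℓ₂ ∷ [])
                       (≤-trans (s≤s (s≤s (s≤s (s≤s (s≤s (s≤s z≤n)))))) 8≤∣D∣)
  ... | p₃ , ℓ₃ , p₃≢p₁ ∷ p₃≢z₁ ∷ p₃≢p₂ ∷ p₃≢z₂ ∷ []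
    with line-avoiding (Line.x∈D ℓ₁) (p₁ ∷ third ℓ₁ ∷ p₂ ∷ third ℓ₂ ∷ p₃ ∷ third ℓ₃ ∷ []) 8≤∣D∣
  ... | p₄ , ℓ₄ , p₄≢p₁ ∷ p₄≢z₁ ∷ p₄≢p₂ ∷ p₄≢z₂ ∷ p₄≢p₃ ∷ p₄≢z₃ ∷ [] = record
    { ℓ₂ = ℓ₂ ; ℓ₃ = ℓ₃ ; ℓ₄ = ℓ₄
    ; distinct = (new-block ℓ₁ ℓ₂ p₂≢p₁ p₂≢z₁ ∷ new-block ℓ₁ ℓ₃ p₃≢p₁ p₃≢z₁ ∷ new-block ℓ₁ ℓ₄ p₄≢p₁ p₄≢z₁ ∷ [])
               ∷ (new-block ℓ₂ ℓ₃ p₃≢p₂ p₃≢z₂ ∷ new-block ℓ₂ ℓ₄ p₄≢p₂ p₄≢z₂ ∷ [])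
               ∷ (new-block ℓ₃ ℓ₄ p₄≢p₃ p₄≢z₃ ∷ [])
               ∷ [] ∷ [] }

  others : ∀ {u} → List (∃ (Line u)) → List (Fin v)
  others []             = []
  others ((p , ℓ) ∷ ls) = p ∷ third ℓ ∷ others ls

  length-others : ∀ {u} (ls : List (∃ (Line u))) → length (others ls) ≡ 2 * length ls
  length-others []       = refl
  length-others (_ ∷ ls) = trans (cong (λ n → suc (suc n)) (length-others ls))
                                 (sym (cong suc (+-suc (length ls) (length ls + 0))))

  DistinctBlocks : ∀ {u} → List (∃ (Line u)) → Set
  DistinctBlocks = AllPairs (λ (_ , ℓ) (_ , ℓ') → block ℓ ≢ block ℓ')

  All-others : ∀ {u} {P : Fin v → Set} {ls : List (∃ (Line u))} →
               All (λ (p , ℓ) → P p × P (third ℓ)) ls → All P (others ls)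
  All-others []                = []
  All-others ((Pp , Pz) ∷ Pls) = Pp ∷ Pz ∷ All-others Pls

  ≢others : ∀ {u x b} → C b → u ∈ b → x ∈ b → x ≢ u → ∀ {ls : List (∃ (Line u))} →
            All (λ (_ , ℓ) → b ≢ block ℓ) ls → All (x ≢_) (others ls)
  ≢others b∈C u∈b x∈b x≢u b≢ls = All-others (All.map (λ {(_ , ℓ)} → off ℓ) b≢ls)
    where
    off : ∀ {p} (ℓ : Line _ p) → _ ≢ block ℓ → _ ≢ p × _ ≢ third ℓ
    off ℓ b≢ℓ = apart b∈C (∈C ℓ) b≢ℓ u∈b (x∈ ℓ) x∈b (y∈ ℓ) x≢u
              , apart b∈C (∈C ℓ) b≢ℓ u∈b (x∈ ℓ) x∈b (third∈ ℓ) x≢u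

  others-distinct : ∀ {u} {ls : List (∃ (Line u))} → DistinctBlocks ls → AllPairs _≢_ (u ∷ others ls)
  others-distinct {ls = ls} distinct = All-others (u≢ ls) ∷ distinct-others distinct
    where
    u≢ : ∀ ls → All (λ (p , ℓ) → _ ≢ p × _ ≢ third ℓ) ls
    u≢ []             = []
    u≢ ((_ , ℓ) ∷ ls) = (Line.x≢y ℓ , x≢third ℓ) ∷ u≢ ls
    distinct-others : ∀ {ls} → DistinctBlocks ls → AllPairs _≢_ (others ls)
    distinct-others [] = []
    distinct-others {(_ , ℓ) ∷ _} (ℓ≢ls ∷ distinct) =
        (y≢third ℓ ∷ ≢others (∈C ℓ) (x∈ ℓ) (y∈ ℓ) (≢-sym (Line.x≢y ℓ)) ℓ≢ls)
      ∷ ≢others (∈C ℓ) (x∈ ℓ) (third∈ ℓ) (≢-sym (x≢third ℓ)) ℓ≢ls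
      ∷ distinct-others distinct

module SteinerQuasigroup {v} {B : Collection v} (S : IsSTS v B) where
  open Steiner S
  open Line using (block; third)

  -- The Steiner quasigroup, with the usual convention x · x = x.
  infixl 7 _·_
  _·_ : Fin v → Fin v → Fin v
  x · y with y ≟ᶠ x
  ... | yes _   = x
  ... | no  y≢x = third (line ∈⊤ ∈⊤ (≢-sym y≢x))

  ·-third : ∀ {x y} (ℓ : Line x y) → x · y ≡ third ℓ
  ·-third {x} {y} ℓ with y ≟ᶠ x
  ... | yes y≡x = ⊥-elim (Line.x≢y ℓ (sym y≡x))
  ... | no  y≢x = third-unique (line ∈⊤ ∈⊤ (≢-sym y≢x)) ℓ

-- Almost-sub-STS(9)s of an STS

module OneAlmostSubSTS9 {v} {B : Collection v} (B-STS : IsSTS v B)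
                        {D C T} (A : AlmostSubSTS9 B D C T) where
  open AlmostSubSTS9 A public
  module 𝔹 = Steiner B-STS
  module ℂ = Steiner isSTS9
  open SteinerQuasigroup B-STS
  open 𝔹.Line using (block; ∈C; third; x∈; y∈; third∈; x≢third; y≢third)

  C⇒B : ∀ {b} → C b → b ≢ T → B b
  C⇒B b∈C b≢T = sub _ (b∈C , b≢T)

  ∣T∣≡3 : ∣ T ∣ ≡ 3
  ∣T∣≡3 = ℂ.block-size T missing∈

  meets-T-once : ∀ {b x y} → C b → b ≢ T → x ≢ y → x ∈ b → y ∈ b → x ∈ T → y ∈ T → ⊥
  meets-T-once b∈C b≢T x≢y x∈b y∈b x∈T y∈T = b≢T (ℂ.same-block x≢y b∈C missing∈ x∈b y∈b x∈T y∈T)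

  8≤∣D∣ : 8 ≤ ∣ D ∣
  8≤∣D∣ = subst (8 ≤_) (sym support-size) (m≤n⇒m≤1+n ≤-refl)

  6≤∣D∖T∣ : 6 ≤ ∣ D ∩ ∁ T ∣
  6≤∣D∖T∣ = begin
    6                 ≤⟨ ∸-monoʳ-≤ 9 (subst (∣ D ∩ T ∣ ≤_) ∣T∣≡3 (∣p∩q∣≤∣q∣ D T)) ⟩
    9 ∸ ∣ D ∩ T ∣     ≡⟨ cong (_∸ ∣ D ∩ T ∣) (sym support-size) ⟩
    ∣ D ∣ ∸ ∣ D ∩ T ∣ ≡⟨ sym (∣p∩∁q∣≡∣p∣∸∣p∩q∣ D T) ⟩
    ∣ D ∩ ∁ T ∣       ∎
    where open ≤-Reasoning

  module _ {r} (r∉D : r ∉ D) where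

    r≢ : ∀ {d} → d ∈ D → r ≢ d
    r≢ d∈D refl = r∉D d∈D

    ray : ∀ {d} → d ∈ D → 𝔹.Line r d
    ray d∈D = 𝔹.line ∈⊤ ∈⊤ (r≢ d∈D)

    -- The C-block through d and r · d would lie in B, hence be the B-block through r.
    ·∉D : ∀ {d} → d ∈ D → d ∉ T → r · d ∉ D
    ·∉D {d} d∈D d∉T rd∈D = r∉D (ℂ.Line.⊆D m (subst (r ∈_) ℓ≡m (x∈ ℓ)))
      where
      ℓ = ray d∈D
      m = ℂ.line d∈D (subst (_∈ D) (·-third ℓ) rd∈D) (y≢third ℓ)
      m≢T : ℂ.Line.block m ≢ T
      m≢T m≡T = d∉T (subst (d ∈_) m≡T (ℂ.Line.x∈ m))
      ℓ≡m = 𝔹.same-block (y≢third ℓ) (∈C ℓ) (C⇒B (ℂ.Line.∈C m) m≢T)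
                         (y∈ ℓ) (third∈ ℓ) (ℂ.Line.x∈ m) (ℂ.Line.y∈ m)

    ·-injective : ∀ {d d'} → d ∈ D → d ∉ T → d' ∈ D → r · d ≡ r · d' → d ≡ d'
    ·-injective {d} {d'} d∈D d∉T d'∈D rd≡rd' with 𝔹.Line.∈-cases ℓ (subst (d' ∈_) (sym ℓ≡ℓ') (y∈ ℓ'))
      where
      ℓ = ray d∈D
      ℓ' = ray d'∈D
      z≡z' = trans (sym (·-third ℓ)) (trans rd≡rd' (·-third ℓ'))
      ℓ≡ℓ' = 𝔹.same-block (x≢third ℓ) (∈C ℓ) (∈C ℓ')
                          (x∈ ℓ) (third∈ ℓ) (x∈ ℓ') (subst (_∈ _) (sym z≡z') (third∈ ℓ'))
    ... | inj₁ d'≡r        = ⊥-elim (r≢ d'∈D (sym d'≡r))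
    ... | inj₂ (inj₁ d'≡d) = sym d'≡d
    ... | inj₂ (inj₂ d'≡z) = ⊥-elim (·∉D d∈D d∉T (subst (_∈ D) (trans d'≡z (sym (·-third (ray d∈D)))) d'∈D))

    ·∉block : ∀ {d a} → d ∈ D → (ℓ' : 𝔹.Line r a) → (∀ {x} → x ∈ block ℓ' → x ∉ D) → r · d ∉ block ℓ'
    ·∉block d∈D ℓ' ℓ'∩D≡∅ rd∈ℓ' = ℓ'∩D≡∅ (subst (_ ∈_) ℓ≡ℓ' (y∈ ℓ)) d∈D
      where
      ℓ = ray d∈D
      ℓ≡ℓ' = 𝔹.same-block (x≢third ℓ) (∈C ℓ) (∈C ℓ') (x∈ ℓ) (third∈ ℓ)
                          (x∈ ℓ') (subst (_∈ _) (·-third ℓ) rd∈ℓ')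

    -- r, the other points of the lines, and the images r · d of six points d ∈ D ∖ T lie outside D.
    outside-lines : (ls : List (∃ (𝔹.Line r))) → 𝔹.DistinctBlocks ls →
                    All (λ (_ , ℓ) → ∀ {x} → x ∈ block ℓ → x ∉ D) ls → 2 * length ls + 7 ≤ ∣ ∁ D ∣
    outside-lines ls distinct ls∩D≡∅ with distinct-elements (D ∩ ∁ T) 6 6≤∣D∖T∣
    ... | ds , ∣ds∣≡6 , ds-distinct , ds⊆D∖T =
      subst (_≤ ∣ ∁ D ∣) count (length≤∣S∣ points-distinct points-outside)
      where
      images = map (r ·_) ds
      ds⊆D = All.map (proj₁ ∘ x∈p∩q⁻ D (∁ T)) ds⊆D∖T
      ds∩T≡∅ = All.map (x∈∁p⇒x∉p ∘ proj₂ ∘ x∈p∩q⁻ D (∁ T)) ds⊆D∖T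
      images-distinct : AllPairs _≢_ images
      images-distinct = AllPairs-map-on (r ·_) (λ (d∈D , d∉T) (d'∈D , _) d≢d' → d≢d' ∘ ·-injective d∈D d∉T d'∈D)
                                        (All.zip (ds⊆D , ds∩T≡∅)) ds-distinct
      r∉images : All (r ≢_) images
      r∉images = All.map⁺ (All.map (λ d∈D → x≢third (ray d∈D) ∘ flip trans (·-third (ray d∈D))) ds⊆D)
      off-images : ∀ {a x} (ℓ : 𝔹.Line r a) → (∀ {y} → y ∈ block ℓ → y ∉ D) → x ∈ block ℓ → All (x ≢_) images
      off-images ℓ ℓ∩D≡∅ x∈ℓ = All.map⁺ (All.map (λ d∈D x≡rd → ·∉block d∈D ℓ ℓ∩D≡∅ (subst (_∈ _) x≡rd x∈ℓ)) ds⊆D)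
      others∉images : All (λ x → All (x ≢_) images) (𝔹.others ls)
      others∉images = 𝔹.All-others (All.map (λ {(_ , ℓ)} ℓ∩D≡∅ → off-images ℓ ℓ∩D≡∅ (y∈ ℓ) , off-images ℓ ℓ∩D≡∅ (third∈ ℓ))
                                            ls∩D≡∅)
      others⊆∁D : All (_∈ ∁ D) (𝔹.others ls)
      others⊆∁D = 𝔹.All-others (All.map (λ {(_ , ℓ)} ℓ∩D≡∅ → x∉p⇒x∈∁p (ℓ∩D≡∅ (y∈ ℓ)) , x∉p⇒x∈∁p (ℓ∩D≡∅ (third∈ ℓ)))
                                        ls∩D≡∅)
      images⊆∁D : All (_∈ ∁ D) images
      images⊆∁D = All.map⁺ (All.zipWith (λ (d∈D , d∉T) → x∉p⇒x∈∁p (·∉D d∈D d∉T)) (ds⊆D , ds∩T≡∅))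
      points-distinct : AllPairs _≢_ ((r ∷ 𝔹.others ls) ++ images)
      points-distinct = ++⁺ (𝔹.others-distinct distinct) images-distinct (r∉images ∷ others∉images)
      points-outside : All (_∈ ∁ D) ((r ∷ 𝔹.others ls) ++ images)
      points-outside = All.++⁺ (x∉p⇒x∈∁p r∉D ∷ others⊆∁D) images⊆∁D
      count : length ((r ∷ 𝔹.others ls) ++ images) ≡ 2 * length ls + 7
      count = begin
        length ((r ∷ 𝔹.others ls) ++ images)       ≡⟨ length-++ (r ∷ 𝔹.others ls) ⟩
        suc (length (𝔹.others ls)) + length images ≡⟨ cong₂ (λ m n → suc m + n) (𝔹.length-others ls)
                                                             (trans (length-map (r ·_) ds) ∣ds∣≡6) ⟩
        suc (2 * length ls) + 6                    ≡⟨ sym (+-suc (2 * length ls) 6) ⟩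
        2 * length ls + 7                          ∎
        where open ≡-Reasoning

module TwoAlmostSubSTS9 {v} {B : Collection v} (B-STS : IsSTS v B) {D₁ C₁ T₁ D₂ C₂ T₂}
                        (A₁ : AlmostSubSTS9 B D₁ C₁ T₁) (A₂ : AlmostSubSTS9 B D₂ C₂ T₂) where
  module 𝔸₁ = OneAlmostSubSTS9 B-STS A₁
  module 𝔸₂ = OneAlmostSubSTS9 B-STS A₂
  module S₁ = 𝔸₁.ℂ
  module S₂ = 𝔸₂.ℂ

  I : Subset v
  I = D₁ ∩ D₂

  ∈I : ∀ {x} → x ∈ D₁ → x ∈ D₂ → x ∈ I
  ∈I x∈D₁ x∈D₂ = x∈p∩q⁺ (x∈D₁ , x∈D₂)

  I⊆D₁ : I ⊆ D₁
  I⊆D₁ = proj₁ ∘ x∈p∩q⁻ D₁ D₂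

  I⊆D₂ : I ⊆ D₂
  I⊆D₂ = proj₂ ∘ x∈p∩q⁻ D₁ D₂

  record Full (x y z : Fin v) : Set where
    field
      block : Subset v
      ∈C₁   : C₁ block
      ∈C₂   : C₂ block
      ≢T₁   : block ≢ T₁
      ≢T₂   : block ≢ T₂
      x∈    : x ∈ block
      y∈    : y ∈ block
      z∈    : z ∈ block
      x≢y   : x ≢ y
      x≢z   : x ≢ z
      y≢z   : y ≢ z

    ⊆I : block ⊆ I
    ⊆I w∈ = ∈I (S₁.block-⊆ block ∈C₁ w∈) (S₂.block-⊆ block ∈C₂ w∈)

    meets-T₁-once : ∀ {p q} → p ≢ q → p ∈ block → q ∈ block → p ∈ T₁ → q ∈ T₁ → ⊥
    meets-T₁-once = 𝔸₁.meets-T-once ∈C₁ ≢T₁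

    meets-T₂-once : ∀ {p q} → p ≢ q → p ∈ block → q ∈ block → p ∈ T₂ → q ∈ T₂ → ⊥
    meets-T₂-once = 𝔸₂.meets-T-once ∈C₂ ≢T₂

  open Full public using (block; ⊆I; ∈C₁; x∈; y∈; z∈; meets-T₁-once; meets-T₂-once)

  rotate : ∀ {x y z} → Full x y z → Full y z x
  rotate F = record { Full F ; x∈ = y∈ F ; y∈ = z∈ F ; z∈ = x∈ F
                     ; x≢y = Full.y≢z F ; x≢z = ≢-sym (Full.x≢y F) ; y≢z = ≢-sym (Full.x≢z F) }

  swap : ∀ {x y z} → Full x y z → Full y x z
  swap F = record { Full F ; x∈ = y∈ F ; y∈ = x∈ F
                   ; x≢y = ≢-sym (Full.x≢y F) ; x≢z = Full.y≢z F ; y≢z = Full.x≢z F }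

  swap₂₃ : ∀ {x y z} → Full x y z → Full x z y
  swap₂₃ = swap ∘ rotate ∘ rotate

  full-line : ∀ {x y} → x ∈ I → y ∈ I → x ≢ y → ¬ (x ∈ T₁ × y ∈ T₁) → ¬ (x ∈ T₂ × y ∈ T₂) → ∃ (Full x y)
  full-line x∈I y∈I x≢y ¬T₁ ¬T₂ = third ℓ₁ , record
    { block = block ℓ₁ ; ∈C₁ = ∈C ℓ₁ ; ∈C₂ = subst C₂ (sym ℓ₁≡ℓ₂) (S₂.Line.∈C ℓ₂)
    ; ≢T₁ = ℓ₁≢T₁ ; ≢T₂ = λ ℓ₁≡T₂ → ℓ₂≢T₂ (trans (sym ℓ₁≡ℓ₂) ℓ₁≡T₂)
    ; x∈ = x∈ ℓ₁ ; y∈ = y∈ ℓ₁ ; z∈ = third∈ ℓ₁ ; x≢y = x≢y ; x≢z = x≢third ℓ₁ ; y≢z = y≢third ℓ₁ }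
    where
    open S₁.Line using (block; ∈C; third; x∈; y∈; third∈; x≢third; y≢third)
    ℓ₁ = S₁.line (I⊆D₁ x∈I) (I⊆D₁ y∈I) x≢y
    ℓ₂ = S₂.line (I⊆D₂ x∈I) (I⊆D₂ y∈I) x≢y
    ℓ₁≢T₁ = ≢-if-¬both (x∈ ℓ₁) (y∈ ℓ₁) ¬T₁
    ℓ₂≢T₂ = ≢-if-¬both (S₂.Line.x∈ ℓ₂) (S₂.Line.y∈ ℓ₂) ¬T₂
    ℓ₁≡ℓ₂ = 𝔸₁.𝔹.same-block x≢y (𝔸₁.C⇒B (∈C ℓ₁) ℓ₁≢T₁) (𝔸₂.C⇒B (S₂.Line.∈C ℓ₂) ℓ₂≢T₂)
                            (x∈ ℓ₁) (y∈ ℓ₁) (S₂.Line.x∈ ℓ₂) (S₂.Line.y∈ ℓ₂)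

  data Cover (x y : Fin v) : Set where
    full  : ∀ {z} → Full x y z → Cover x y
    in-T₁ : x ∈ T₁ → y ∈ T₁ → Cover x y
    in-T₂ : x ∈ T₂ → y ∈ T₂ → Cover x y

  cover : ∀ {x y} → x ∈ I → y ∈ I → x ≢ y → Cover x y
  cover {x} {y} x∈I y∈I x≢y with x ∈? T₁ ×-dec y ∈? T₁ | x ∈? T₂ ×-dec y ∈? T₂
  ... | yes (x∈T₁ , y∈T₁) | _                   = in-T₁ x∈T₁ y∈T₁
  ... | no _              | yes (x∈T₂ , y∈T₂)   = in-T₂ x∈T₂ y∈T₂
  ... | no ¬T₁            | no ¬T₂              = full (proj₂ (full-line x∈I y∈I x≢y ¬T₁ ¬T₂))

  triangle : ∀ {x y z w t s} (L₁ : Full x y z) (L₂ : Full x w t) (L₃ : Full w y s) →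
             block L₁ ≢ block L₂ → 6 ≤ ∣ I ∣
  triangle {x} {y} {z} {w} {t} {s} L₁ L₂ L₃ L₁≢L₂ = length≤∣S∣ distinct
    (⊆I L₁ (x∈ L₁) ∷ ⊆I L₁ (y∈ L₁) ∷ ⊆I L₁ (z∈ L₁) ∷ ⊆I L₂ (y∈ L₂) ∷ ⊆I L₂ (z∈ L₂) ∷ ⊆I L₃ (z∈ L₃) ∷ [])
    where
    open Full using (x≢y; x≢z; y≢z)
    w∉L₁ : w ∉ block L₁
    w∉L₁ w∈L₁ = L₁≢L₂ (S₁.same-block (x≢y L₂) (∈C₁ L₁) (∈C₁ L₂) (x∈ L₁) w∈L₁ (x∈ L₂) (y∈ L₂))
    L₁≢L₃ : block L₁ ≢ block L₃
    L₁≢L₃ L₁≡L₃ = w∉L₁ (subst (w ∈_) (sym L₁≡L₃) (x∈ L₃))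
    L₂≢L₃ : block L₂ ≢ block L₃
    L₂≢L₃ L₂≡L₃ = L₁≢L₂ (S₁.same-block (x≢y L₁) (∈C₁ L₁) (∈C₁ L₂) (x∈ L₁) (y∈ L₁)
                                       (x∈ L₂) (subst (y ∈_) (sym L₂≡L₃) (y∈ L₃)))
    apart₁₂ : ∀ {a c} → a ∈ block L₁ → c ∈ block L₂ → a ≢ x → a ≢ c
    apart₁₂ = S₁.apart (∈C₁ L₁) (∈C₁ L₂) L₁≢L₂ (x∈ L₁) (x∈ L₂)
    apart₁₃ : ∀ {a c} → a ∈ block L₁ → c ∈ block L₃ → a ≢ y → a ≢ c
    apart₁₃ = S₁.apart (∈C₁ L₁) (∈C₁ L₃) L₁≢L₃ (y∈ L₁) (y∈ L₃)
    apart₂₃ : ∀ {a c} → a ∈ block L₂ → c ∈ block L₃ → a ≢ w → a ≢ c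
    apart₂₃ = S₁.apart (∈C₁ L₂) (∈C₁ L₃) L₂≢L₃ (y∈ L₂) (x∈ L₃)
    distinct : AllPairs _≢_ (x ∷ y ∷ z ∷ w ∷ t ∷ s ∷ [])
    distinct =
        (x≢y L₁ ∷ x≢z L₁ ∷ x≢y L₂ ∷ x≢z L₂ ∷ apart₁₃ (x∈ L₁) (z∈ L₃) (x≢y L₁) ∷ [])
      ∷ (y≢z L₁ ∷ ≢-sym (x≢y L₃) ∷ apart₁₂ (y∈ L₁) (z∈ L₂) (≢-sym (x≢y L₁)) ∷ y≢z L₃ ∷ [])
      ∷ (apart₁₂ (z∈ L₁) (y∈ L₂) (≢-sym (x≢z L₁)) ∷ apart₁₂ (z∈ L₁) (z∈ L₂) (≢-sym (x≢z L₁))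
         ∷ apart₁₃ (z∈ L₁) (z∈ L₃) (≢-sym (y≢z L₁)) ∷ [])
      ∷ (y≢z L₂ ∷ x≢z L₃ ∷ [])
      ∷ (apart₂₃ (z∈ L₂) (z∈ L₃) (≢-sym (y≢z L₂)) ∷ [])
      ∷ [] ∷ []

  full-from : ∀ {a b c d} → a ∉ T₁ → AllPairs _≢_ (a ∷ b ∷ c ∷ d ∷ []) → All (_∈ I) (a ∷ b ∷ c ∷ d ∷ []) →
              ∃[ x ] ∃[ y ] ∃[ z ] Full x y z
  full-from a∉T₁ distinct@((a≢b ∷ a≢c ∷ a≢d ∷ []) ∷ _) (a∈I ∷ b∈I ∷ c∈I ∷ d∈I ∷ [])
    with cover a∈I b∈I a≢b | cover a∈I c∈I a≢c | cover a∈I d∈I a≢d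
  ... | full F        | _             | _             = _ , _ , _ , F
  ... | _             | full F        | _             = _ , _ , _ , F
  ... | _             | _             | full F        = _ , _ , _ , F
  ... | in-T₁ a∈T₁ _  | _             | _             = ⊥-elim (a∉T₁ a∈T₁)
  ... | _             | in-T₁ a∈T₁ _  | _             = ⊥-elim (a∉T₁ a∈T₁)
  ... | _             | _             | in-T₁ a∈T₁ _  = ⊥-elim (a∉T₁ a∈T₁)
  ... | in-T₂ a∈T₂ b∈T₂ | in-T₂ _ c∈T₂ | in-T₂ _ d∈T₂ =
    ⊥-elim (Triple.no-four 𝔸₂.∣T∣≡3 distinct (a∈T₂ ∷ b∈T₂ ∷ c∈T₂ ∷ d∈T₂ ∷ []))

  some-full : 4 ≤ ∣ I ∣ → ∃[ x ] ∃[ y ] ∃[ z ] Full x y z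
  some-full 4≤∣I∣ with fresh (I ∩ ∁ T₁) [] 0<∣I∖T₁∣
    where
    0<∣I∖T₁∣ : 0 < ∣ I ∩ ∁ T₁ ∣
    0<∣I∖T₁∣ = begin
      1                   ≤⟨ ∸-mono 4≤∣I∣ (subst (∣ I ∩ T₁ ∣ ≤_) 𝔸₁.∣T∣≡3 (∣p∩q∣≤∣q∣ I T₁)) ⟩
      ∣ I ∣ ∸ ∣ I ∩ T₁ ∣  ≡⟨ sym (∣p∩∁q∣≡∣p∣∸∣p∩q∣ I T₁) ⟩
      ∣ I ∩ ∁ T₁ ∣        ∎
      where open ≤-Reasoning
  ... | a , a∈I∖T₁ , [] with distinct-elements (remove a I) 3 (≤-pred (≤-trans 4≤∣I∣ (∣p∣≤1+∣remove∣ I a)))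
  ... | b ∷ c ∷ d ∷ [] , refl , distinct , b∈ ∷ c∈ ∷ d∈ ∷ [] =
    let a∈I , a∈∁T₁ = x∈p∩q⁻ I (∁ T₁) a∈I∖T₁
        b∈I , b≢a = ∈-remove⁻ b∈
        c∈I , c≢a = ∈-remove⁻ c∈
        d∈I , d≢a = ∈-remove⁻ d∈
    in full-from (x∈∁p⇒x∉p a∈∁T₁) ((≢-sym b≢a ∷ ≢-sym c≢a ∷ ≢-sym d≢a ∷ []) ∷ distinct)
                 (a∈I ∷ b∈I ∷ c∈I ∷ d∈I ∷ [])

  module _ (∣I∣≤5 : ∣ I ∣ ≤ 5) where

    no-triangle : ∀ {x y z w t s} (L₁ : Full x y z) (L₂ : Full x w t) (L₃ : Full w y s) →
                  block L₁ ≢ block L₂ → ⊥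
    no-triangle L₁ L₂ L₃ L₁≢L₂ = <⇒≱ (triangle L₁ L₂ L₃ L₁≢L₂) ∣I∣≤5

    module Off {x y z w t} (F : Full x y z) (M : Full w x t) (w∉F : w ∉ block F) where
      open Full using (x≢y; x≢z; y≢z)

      F≢M : block F ≢ block M
      F≢M F≡M = w∉F (subst (w ∈_) (sym F≡M) (x∈ M))

      t≢ : ∀ {a} → a ∈ block F → a ≢ x → t ≢ a
      t≢ a∈F a≢x = ≢-sym (S₁.apart (∈C₁ F) (∈C₁ M) F≢M (x∈ F) (y∈ M) a∈F (z∈ M) a≢x)

      -- Neither ty nor tz lies in T₁ (M would meet T₁ twice), and not both lie in T₂ (F would meet T₂
      -- twice), so one of them spans a full line closing a triangle.
      mixed : w ∈ T₁ → y ∈ T₁ → w ∈ T₂ → z ∈ T₂ → ⊥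
      mixed w∈T₁ y∈T₁ w∈T₂ z∈T₂ with cover (⊆I M (z∈ M)) (⊆I F (y∈ F)) (t≢ (y∈ F) (≢-sym (x≢y F)))
      ... | full N       = no-triangle F (rotate M) N F≢M
      ... | in-T₁ t∈T₁ _ = meets-T₁-once M (x≢z M) (x∈ M) (z∈ M) w∈T₁ t∈T₁
      ... | in-T₂ _ y∈T₂ with cover (⊆I M (z∈ M)) (⊆I F (z∈ F)) (t≢ (z∈ F) (≢-sym (x≢z F)))
      ...   | full N       = no-triangle (swap₂₃ F) (rotate M) N F≢M
      ...   | in-T₁ t∈T₁ _ = meets-T₁-once M (x≢z M) (x∈ M) (z∈ M) w∈T₁ t∈T₁
      ...   | in-T₂ _ _    = meets-T₂-once F (y≢z F) (y∈ F) (z∈ F) y∈T₂ z∈T₂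

    with-full : ∀ {x y z w t} (F : Full x y z) (M : Full w x t) → w ∉ block F → ⊥
    with-full F M w∉F with cover w∈I (⊆I F (y∈ F)) (∉⇒≢ w∉F (y∈ F)) | cover w∈I (⊆I F (z∈ F)) (∉⇒≢ w∉F (z∈ F))
      where w∈I = ⊆I M (x∈ M)
    ... | full N          | _               = no-triangle F (swap M) N (Off.F≢M F M w∉F)
    ... | _               | full N          = no-triangle (swap₂₃ F) (swap M) N (Off.F≢M F M w∉F)
    ... | in-T₁ _ y∈T₁    | in-T₁ _ z∈T₁    = meets-T₁-once F (Full.y≢z F) (y∈ F) (z∈ F) y∈T₁ z∈T₁
    ... | in-T₂ _ y∈T₂    | in-T₂ _ z∈T₂    = meets-T₂-once F (Full.y≢z F) (y∈ F) (z∈ F) y∈T₂ z∈T₂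
    ... | in-T₁ w∈T₁ y∈T₁ | in-T₂ w∈T₂ z∈T₂ = Off.mixed F M w∉F w∈T₁ y∈T₁ w∈T₂ z∈T₂
    ... | in-T₂ w∈T₂ y∈T₂ | in-T₁ w∈T₁ z∈T₁ = Off.mixed (swap₂₃ F) M w∉F w∈T₁ z∈T₁ w∈T₂ y∈T₂

    I⊆full : ∀ {x y z} (F : Full x y z) → I ⊆ block F
    I⊆full F {w} w∈I with w ∈? block F
    ... | yes w∈F = w∈F
    ... | no  w∉F with cover w∈I (⊆I F (x∈ F)) (∉⇒≢ w∉F (x∈ F)) | cover w∈I (⊆I F (y∈ F)) (∉⇒≢ w∉F (y∈ F))
                     | cover w∈I (⊆I F (z∈ F)) (∉⇒≢ w∉F (z∈ F))
    ... | full M       | _            | _            = ⊥-elim (with-full F M w∉F)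
    ... | _            | full M       | _            = ⊥-elim (with-full (rotate F) M w∉F)
    ... | _            | _            | full M       = ⊥-elim (with-full (rotate (rotate F)) M w∉F)
    ... | in-T₁ _ x∈T₁ | in-T₁ _ y∈T₁ | _            = ⊥-elim (meets-T₁-once F (Full.x≢y F) (x∈ F) (y∈ F) x∈T₁ y∈T₁)
    ... | in-T₂ _ x∈T₂ | in-T₂ _ y∈T₂ | _            = ⊥-elim (meets-T₂-once F (Full.x≢y F) (x∈ F) (y∈ F) x∈T₂ y∈T₂)
    ... | in-T₁ _ x∈T₁ | in-T₂ _ _    | in-T₁ _ z∈T₁ = ⊥-elim (meets-T₁-once F (Full.x≢z F) (x∈ F) (z∈ F) x∈T₁ z∈T₁)
    ... | in-T₁ _ _    | in-T₂ _ y∈T₂ | in-T₂ _ z∈T₂ = ⊥-elim (meets-T₂-once F (Full.y≢z F) (y∈ F) (z∈ F) y∈T₂ z∈T₂)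
    ... | in-T₂ _ _    | in-T₁ _ y∈T₁ | in-T₁ _ z∈T₁ = ⊥-elim (meets-T₁-once F (Full.y≢z F) (y∈ F) (z∈ F) y∈T₁ z∈T₁)
    ... | in-T₂ _ x∈T₂ | in-T₁ _ _    | in-T₂ _ z∈T₂ = ⊥-elim (meets-T₂-once F (Full.x≢z F) (x∈ F) (z∈ F) x∈T₂ z∈T₂)

    ∣I∣≤5⇒∣I∣≤3 : ∣ I ∣ ≤ 3
    ∣I∣≤5⇒∣I∣≤3 with ∣ I ∣ ≤? 3
    ... | yes ∣I∣≤3 = ∣I∣≤3
    ... | no  ∣I∣≰3 with some-full (≰⇒> ∣I∣≰3)
    ... | _ , _ , _ , F = subst (∣ I ∣ ≤_) (S₁.block-size _ (∈C₁ F)) (p⊆q⇒∣p∣≤∣q∣ (I⊆full F))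

  J : Subset v
  J = D₁ ∩ ∁ D₂

  module Star {u} (u∈D₁ : u ∈ D₁) (u∉D₂ : u ∉ D₂) where
    open S₁.Line using (block; third; ∈C; x∈; y∈; third∈; x≢y; x≢third; y≢third)

    InT₂ : ∀ {p} → S₁.Line u p → Set
    InT₂ {p} ℓ = p ∈ T₂ × third ℓ ∈ T₂

    MeetsJ : ∀ {p} → S₁.Line u p → Set
    MeetsJ ℓ = ∃[ j ] j ∈ block ℓ × j ≢ u × j ∈ J

    -- If both other points lie in D₂, the C₂-block through them is T₂ or else equals ℓ,
    -- which contains u ∉ D₂.
    in-T₂-or-meets-J : ∀ {p} (ℓ : S₁.Line u p) → block ℓ ≢ T₁ → InT₂ ℓ ⊎ MeetsJ ℓ
    in-T₂-or-meets-J {p} ℓ ℓ≢T₁ with p ∈? D₂ | third ℓ ∈? D₂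
    ... | no p∉D₂  | _        = inj₂ (p , y∈ ℓ , ≢-sym (x≢y ℓ) , x∈p∩q⁺ (S₁.Line.⊆D ℓ (y∈ ℓ) , x∉p⇒x∈∁p p∉D₂))
    ... | yes _    | no z∉D₂  = inj₂ (third ℓ , third∈ ℓ , ≢-sym (x≢third ℓ) ,
                                     x∈p∩q⁺ (S₁.Line.⊆D ℓ (third∈ ℓ) , x∉p⇒x∈∁p z∉D₂))
    ... | yes p∈D₂ | yes z∈D₂ with p ∈? T₂ ×-dec third ℓ ∈? T₂
    ...   | yes p,z∈T₂ = inj₁ p,z∈T₂
    ...   | no ¬in-T₂ = ⊥-elim (u∉D₂ (S₂.Line.⊆D m (subst (u ∈_) ℓ≡m (x∈ ℓ))))
      where
      m = S₂.line p∈D₂ z∈D₂ (y≢third ℓ)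
      m≢T₂ = ≢-if-¬both (S₂.Line.x∈ m) (S₂.Line.y∈ m) ¬in-T₂
      ℓ≡m = 𝔸₁.𝔹.same-block (y≢third ℓ) (𝔸₁.C⇒B (∈C ℓ) ℓ≢T₁) (𝔸₂.C⇒B (S₂.Line.∈C m) m≢T₂)
                            (y∈ ℓ) (third∈ ℓ) (S₂.Line.x∈ m) (S₂.Line.y∈ m)

    two-in-T₂ : ∀ {p p'} (ℓ : S₁.Line u p) (ℓ' : S₁.Line u p') → block ℓ ≢ block ℓ' → InT₂ ℓ → InT₂ ℓ' → ⊥
    two-in-T₂ ℓ ℓ' ℓ≢ℓ' (p∈T₂ , z∈T₂) (p'∈T₂ , z'∈T₂)
      with S₁.others-distinct {ls = (_ , ℓ) ∷ (_ , ℓ') ∷ []} ((ℓ≢ℓ' ∷ []) ∷ [] ∷ [])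
    ... | _ ∷ distinct = Triple.no-four 𝔸₂.∣T∣≡3 distinct (p∈T₂ ∷ z∈T₂ ∷ p'∈T₂ ∷ z'∈T₂ ∷ [])

    three-meet-J : ∀ {p p' p''} (ℓ : S₁.Line u p) (ℓ' : S₁.Line u p') (ℓ'' : S₁.Line u p'') →
                   AllPairs _≢_ (block ℓ ∷ block ℓ' ∷ block ℓ'' ∷ []) → MeetsJ ℓ → MeetsJ ℓ' → MeetsJ ℓ'' →
                   4 ≤ ∣ J ∣
    three-meet-J ℓ ℓ' ℓ'' ((ℓ≢ℓ' ∷ ℓ≢ℓ'' ∷ []) ∷ (ℓ'≢ℓ'' ∷ []) ∷ [] ∷ [])
                 (j , j∈ℓ , j≢u , j∈J) (j' , j'∈ℓ' , j'≢u , j'∈J) (j'' , j''∈ℓ'' , j''≢u , j''∈J) =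
      length≤∣S∣ ((≢-sym j≢u ∷ ≢-sym j'≢u ∷ ≢-sym j''≢u ∷ [])
                  ∷ (apart ℓ ℓ' ℓ≢ℓ' j∈ℓ j'∈ℓ' j≢u ∷ apart ℓ ℓ'' ℓ≢ℓ'' j∈ℓ j''∈ℓ'' j≢u ∷ [])
                  ∷ (apart ℓ' ℓ'' ℓ'≢ℓ'' j'∈ℓ' j''∈ℓ'' j'≢u ∷ [])
                  ∷ [] ∷ [])
                 (x∈p∩q⁺ (u∈D₁ , x∉p⇒x∈∁p u∉D₂) ∷ j∈J ∷ j'∈J ∷ j''∈J ∷ [])
      where
      apart : ∀ {p p' a c} (ℓ : S₁.Line u p) (ℓ' : S₁.Line u p') → block ℓ ≢ block ℓ' →
              a ∈ block ℓ → c ∈ block ℓ' → a ≢ u → a ≢ c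
      apart ℓ ℓ' ℓ≢ℓ' = S₁.apart (∈C ℓ) (∈C ℓ') ℓ≢ℓ' (x∈ ℓ) (x∈ ℓ')

    u∉T₁⇒4≤∣J∣ : u ∉ T₁ → 4 ≤ ∣ J ∣
    u∉T₁⇒4≤∣J∣ u∉T₁ with S₁.line-avoiding u∈D₁ [] (subst (1 <_) (sym 𝔸₁.support-size) (s≤s (s≤s z≤n)))
    ... | _ , ℓ₁ , [] with S₁.pencil 𝔸₁.8≤∣D∣ ℓ₁
    ... | record { ℓ₂ = ℓ₂ ; ℓ₃ = ℓ₃ ; ℓ₄ = ℓ₄
                 ; distinct = (n₁₂ ∷ n₁₃ ∷ n₁₄ ∷ []) ∷ (n₂₃ ∷ n₂₄ ∷ []) ∷ (n₃₄ ∷ []) ∷ [] ∷ [] }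
      with kind ℓ₁ | kind ℓ₂ | kind ℓ₃ | kind ℓ₄
      where
      kind : ∀ {p} (ℓ : S₁.Line u p) → InT₂ ℓ ⊎ MeetsJ ℓ
      kind ℓ = in-T₂-or-meets-J ℓ (λ ℓ≡T₁ → u∉T₁ (subst (u ∈_) ℓ≡T₁ (x∈ ℓ)))
    ... | inj₁ a | inj₁ b | _      | _      = ⊥-elim (two-in-T₂ ℓ₁ ℓ₂ n₁₂ a b)
    ... | inj₁ a | inj₂ _ | inj₁ c | _      = ⊥-elim (two-in-T₂ ℓ₁ ℓ₃ n₁₃ a c)
    ... | inj₁ a | inj₂ _ | inj₂ _ | inj₁ d = ⊥-elim (two-in-T₂ ℓ₁ ℓ₄ n₁₄ a d)
    ... | inj₁ _ | inj₂ b | inj₂ c | inj₂ d = three-meet-J ℓ₂ ℓ₃ ℓ₄ ((n₂₃ ∷ n₂₄ ∷ []) ∷ (n₃₄ ∷ []) ∷ [] ∷ []) b c d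
    ... | inj₂ _ | inj₁ b | inj₁ c | _      = ⊥-elim (two-in-T₂ ℓ₂ ℓ₃ n₂₃ b c)
    ... | inj₂ _ | inj₁ b | inj₂ _ | inj₁ d = ⊥-elim (two-in-T₂ ℓ₂ ℓ₄ n₂₄ b d)
    ... | inj₂ a | inj₁ _ | inj₂ c | inj₂ d = three-meet-J ℓ₁ ℓ₃ ℓ₄ ((n₁₃ ∷ n₁₄ ∷ []) ∷ (n₃₄ ∷ []) ∷ [] ∷ []) a c d
    ... | inj₂ _ | inj₂ _ | inj₁ c | inj₁ d = ⊥-elim (two-in-T₂ ℓ₃ ℓ₄ n₃₄ c d)
    ... | inj₂ a | inj₂ b | inj₁ _ | inj₂ d = three-meet-J ℓ₁ ℓ₂ ℓ₄ ((n₁₂ ∷ n₁₄ ∷ []) ∷ (n₂₄ ∷ []) ∷ [] ∷ []) a b d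
    ... | inj₂ a | inj₂ b | inj₂ c | _      = three-meet-J ℓ₁ ℓ₂ ℓ₃ ((n₁₂ ∷ n₁₃ ∷ []) ∷ (n₂₃ ∷ []) ∷ [] ∷ []) a b c

    off-T₁ : ∀ {p} (ℓ : S₁.Line u p) → u ∈ T₁ → block ℓ ≢ T₁ → MeetsJ ℓ → ∃[ j ] j ∈ J × j ∉ T₁
    off-T₁ ℓ u∈T₁ ℓ≢T₁ (j , j∈ℓ , j≢u , j∈J) =
      j , j∈J , λ j∈T₁ → ℓ≢T₁ (S₁.same-block (≢-sym j≢u) (∈C ℓ) 𝔸₁.missing∈ (x∈ ℓ) j∈ℓ u∈T₁ j∈T₁)

    -- Complete T₁ to a pencil at u: the other three lines cannot all have their points in T₂.
    u∈T₁⇒J⊈T₁ : u ∈ T₁ → ∃[ j ] j ∈ J × j ∉ T₁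
    u∈T₁⇒J⊈T₁ u∈T₁ with fresh T₁ (u ∷ []) (subst (1 <_) (sym 𝔸₁.∣T∣≡3) (s≤s (s≤s z≤n)))
    ... | p , p∈T₁ , p≢u ∷ [] with S₁.pencil 𝔸₁.8≤∣D∣ (S₁.block→Line 𝔸₁.missing∈ u∈T₁ p∈T₁ (≢-sym p≢u))
    ... | record { ℓ₂ = ℓ₂ ; ℓ₃ = ℓ₃ ; ℓ₄ = ℓ₄
                 ; distinct = (T₁≢ℓ₂ ∷ T₁≢ℓ₃ ∷ T₁≢ℓ₄ ∷ []) ∷ (n₂₃ ∷ _) ∷ _ }
      with in-T₂-or-meets-J ℓ₂ (≢-sym T₁≢ℓ₂) | in-T₂-or-meets-J ℓ₃ (≢-sym T₁≢ℓ₃)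
         | in-T₂-or-meets-J ℓ₄ (≢-sym T₁≢ℓ₄)
    ... | inj₂ m | _      | _      = off-T₁ ℓ₂ u∈T₁ (≢-sym T₁≢ℓ₂) m
    ... | _      | inj₂ m | _      = off-T₁ ℓ₃ u∈T₁ (≢-sym T₁≢ℓ₃) m
    ... | _      | _      | inj₂ m = off-T₁ ℓ₄ u∈T₁ (≢-sym T₁≢ℓ₄) m
    ... | inj₁ a | inj₁ b | inj₁ _ = ⊥-elim (two-in-T₂ ℓ₂ ℓ₃ n₂₃ a b)

  ∈J⇒4≤∣J∣ : ∀ {u} → u ∈ J → 4 ≤ ∣ J ∣
  ∈J⇒4≤∣J∣ {u} u∈J with x∈p∩q⁻ D₁ (∁ D₂) u∈J
  ... | u∈D₁ , u∈∁D₂ with u ∈? T₁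
  ...   | no  u∉T₁ = Star.u∉T₁⇒4≤∣J∣ u∈D₁ (x∈∁p⇒x∉p u∈∁D₂) u∉T₁
  ...   | yes u∈T₁ with Star.u∈T₁⇒J⊈T₁ u∈D₁ (x∈∁p⇒x∉p u∈∁D₂) u∈T₁
  ...     | j , j∈J , j∉T₁ =
    let j∈D₁ , j∈∁D₂ = x∈p∩q⁻ D₁ (∁ D₂) j∈J in Star.u∉T₁⇒4≤∣J∣ j∈D₁ (x∈∁p⇒x∉p j∈∁D₂) j∉T₁

  J≡∅⇒D₁≡D₂ : (∀ {x} → x ∉ J) → D₁ ≡ D₂
  J≡∅⇒D₁≡D₂ J≡∅ = ⊆∧∣∣≥⇒≡ D₁⊆D₂ (≤-reflexive (trans 𝔸₂.support-size (sym 𝔸₁.support-size)))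
    where
    D₁⊆D₂ : D₁ ⊆ D₂
    D₁⊆D₂ {x} x∈D₁ with x ∈? D₂
    ... | yes x∈D₂ = x∈D₂
    ... | no  x∉D₂ = ⊥-elim (J≡∅ (x∈p∩q⁺ (x∈D₁ , x∉p⇒x∈∁p x∉D₂)))

  ∣I∣≤3 : D₁ ≢ D₂ → ∣ I ∣ ≤ 3
  ∣I∣≤3 D₁≢D₂ with ∣ I ∣ ≤? 5
  ... | yes ∣I∣≤5 = ∣I∣≤5⇒∣I∣≤3 ∣I∣≤5
  ... | no  ∣I∣≰5 with nonempty? J
  ...   | no  J≡∅         = ⊥-elim (D₁≢D₂ (J≡∅⇒D₁≡D₂ (λ x∈J → J≡∅ (_ , x∈J))))
  ...   | yes (_ , u∈J)   = ⊥-elim (<⇒≱ (∈J⇒4≤∣J∣ u∈J) ∣J∣≤3)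
    where
    open ≤-Reasoning
    ∣J∣≤3 : ∣ J ∣ ≤ 3
    ∣J∣≤3 = begin
      ∣ J ∣           ≡⟨ ∣p∩∁q∣≡∣p∣∸∣p∩q∣ D₁ D₂ ⟩
      ∣ D₁ ∣ ∸ ∣ I ∣  ≡⟨ cong (_∸ ∣ I ∣) 𝔸₁.support-size ⟩
      9 ∸ ∣ I ∣       ≤⟨ ∸-monoʳ-≤ 9 (≰⇒> ∣I∣≰5) ⟩
      3               ∎

  I⊆line⇒13≤∣∁D₁∣ : ∀ {w e} → w ∉ D₁ → (ℓ : S₂.Line w e) → I ⊆ S₂.Line.block ℓ →
                    w ∉ T₂ ⊎ S₂.Line.block ℓ ≡ T₂ → 13 ≤ ∣ ∁ D₁ ∣
  I⊆line⇒13≤∣∁D₁∣ {w} w∉D₁ ℓ I⊆ℓ w∉T₂⊎ℓ≡T₂ with S₂.pencil 𝔸₂.8≤∣D∣ ℓ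
  ... | record { ℓ₂ = ℓ₂ ; ℓ₃ = ℓ₃ ; ℓ₄ = ℓ₄
               ; distinct = (n₁₂ ∷ n₁₃ ∷ n₁₄ ∷ []) ∷ (n₂₃ ∷ n₂₄ ∷ []) ∷ (n₃₄ ∷ []) ∷ [] ∷ [] } =
    𝔸₁.outside-lines w∉D₁ ((_ , in-B ℓ₂ n₁₂) ∷ (_ , in-B ℓ₃ n₁₃) ∷ (_ , in-B ℓ₄ n₁₄) ∷ [])
                     ((n₂₃ ∷ n₂₄ ∷ []) ∷ (n₃₄ ∷ []) ∷ [] ∷ [])
                     (off-D₁ ℓ₂ n₁₂ ∷ off-D₁ ℓ₃ n₁₃ ∷ off-D₁ ℓ₄ n₁₄ ∷ [])
    where
    open S₂.Line using (block; ∈C; x∈; y∈; x≢y; ⊆D)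
    ≢T₂ : ∀ {p} (k : S₂.Line w p) → block ℓ ≢ block k → block k ≢ T₂
    ≢T₂ k ℓ≢k k≡T₂ = [ (λ w∉T₂ → w∉T₂ (subst (w ∈_) k≡T₂ (x∈ k)))
                      , (λ ℓ≡T₂ → ℓ≢k (trans ℓ≡T₂ (sym k≡T₂))) ]′ w∉T₂⊎ℓ≡T₂
    in-B : ∀ {p} (k : S₂.Line w p) → block ℓ ≢ block k → 𝔸₁.𝔹.Line w p
    in-B k ℓ≢k = 𝔸₁.𝔹.block→Line (𝔸₂.C⇒B (∈C k) (≢T₂ k ℓ≢k)) (x∈ k) (y∈ k) (x≢y k)
    -- A point of k in D₁ would lie in I ⊆ ℓ, but ℓ and k meet only in w ∉ D₁.
    off-D₁ : ∀ {p} (k : S₂.Line w p) → block ℓ ≢ block k → ∀ {x} → x ∈ block k → x ∉ D₁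
    off-D₁ k ℓ≢k {x} x∈k x∈D₁ with x ≟ᶠ w
    ... | yes refl = w∉D₁ x∈D₁
    ... | no  x≢w  = S₂.apart (∈C ℓ) (∈C k) ℓ≢k (x∈ ℓ) (x∈ k) (I⊆ℓ (∈I x∈D₁ (⊆D k x∈k))) x∈k x≢w refl

  I⊆point⇒13≤∣∁D₁∣ : ∀ {a} → a ∈ D₂ → (∀ {x} → x ∈ I → x ≡ a) → 13 ≤ ∣ ∁ D₁ ∣
  I⊆point⇒13≤∣∁D₁∣ {a} a∈D₂ I⊆a with fresh (D₂ ∩ ∁ T₂) (a ∷ []) (≤-trans (s≤s (s≤s z≤n)) 𝔸₂.6≤∣D∖T∣)
  ... | w , w∈D₂∖T₂ , w≢a ∷ [] =
    let w∈D₂ , w∈∁T₂ = x∈p∩q⁻ D₂ (∁ T₂) w∈D₂∖T₂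
        ℓ = S₂.line w∈D₂ a∈D₂ w≢a
    in I⊆line⇒13≤∣∁D₁∣ (λ w∈D₁ → w≢a (I⊆a (∈I w∈D₁ w∈D₂))) ℓ
                       (λ x∈I → subst (_∈ _) (sym (I⊆a x∈I)) (S₂.Line.y∈ ℓ)) (inj₁ (x∈∁p⇒x∉p w∈∁T₂))

  ∣I∣≤1⇒13≤∣∁D₁∣ : ∣ I ∣ ≤ 1 → 13 ≤ ∣ ∁ D₁ ∣
  ∣I∣≤1⇒13≤∣∁D₁∣ ∣I∣≤1 with nonempty? I
  ... | yes (a , a∈I) = I⊆point⇒13≤∣∁D₁∣ (I⊆D₂ a∈I) I⊆a
    where
    I⊆a : ∀ {x} → x ∈ I → x ≡ a
    I⊆a x∈I with ∣S∣≤length⇒∈ ([] ∷ []) (a∈I ∷ []) ∣I∣≤1 x∈I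
    ... | here x≡a = x≡a
  ... | no  I≡∅ with fresh D₂ [] (subst (0 <_) (sym 𝔸₂.support-size) (s≤s z≤n))
  ...   | a , a∈D₂ , [] = I⊆point⇒13≤∣∁D₁∣ a∈D₂ (λ x∈I → ⊥-elim (I≡∅ (_ , x∈I)))

  I⊆T₂⇒13≤∣∁D₁∣ : ∀ {a b} → a ≢ b → a ∈ T₂ → b ∈ T₂ → (∀ {x} → x ∈ I → x ≡ a ⊎ x ≡ b) → 13 ≤ ∣ ∁ D₁ ∣
  I⊆T₂⇒13≤∣∁D₁∣ a≢b a∈T₂ b∈T₂ I⊆ab =
    I⊆line⇒13≤∣∁D₁∣ w∉D₁ (S₂.block→Line 𝔸₂.missing∈ (third∈ T₂-line) a∈T₂ (≢-sym (x≢third T₂-line)))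
                    I⊆T₂ (inj₂ refl)
    where
    open S₂.Line using (third; third∈; x≢third; y≢third; ⊆D)
    T₂-line = S₂.block→Line 𝔸₂.missing∈ a∈T₂ b∈T₂ a≢b
    w∉D₁ : third T₂-line ∉ D₁
    w∉D₁ w∈D₁ with I⊆ab (∈I w∈D₁ (⊆D T₂-line (third∈ T₂-line)))
    ... | inj₁ w≡a = x≢third T₂-line (sym w≡a)
    ... | inj₂ w≡b = y≢third T₂-line (sym w≡b)
    I⊆T₂ : I ⊆ T₂
    I⊆T₂ x∈I with I⊆ab x∈I
    ... | inj₁ refl = a∈T₂
    ... | inj₂ refl = b∈T₂

  full⇒≡I : ∀ {a b c} → ∣ I ∣ ≡ 3 → (F : Full a b c) → block F ≡ I
  full⇒≡I ∣I∣≡3 F = ⊆∧∣∣≥⇒≡ (⊆I F) (≤-reflexive (trans ∣I∣≡3 (sym (S₁.block-size _ (∈C₁ F)))))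

  Shape : Set
  Shape = (Remove C₁ T₁ I × Remove C₂ T₂ I) ⊎ (I ≡ T₁ ⊎ I ≡ T₂)

  module Three (∣I∣≡3 : ∣ I ∣ ≡ 3) {x y z} (x≢y : x ≢ y) (x≢z : x ≢ z) (y≢z : y ≢ z)
               (x∈I : x ∈ I) (y∈I : y ∈ I) (z∈I : z ∈ I) where

    I≡ : ∀ {T} → ∣ T ∣ ≡ 3 → x ∈ T → y ∈ T → z ∈ T → I ≡ T
    I≡ ∣T∣≡3 x∈T y∈T z∈T =
      sym (Triple.≡-if-three-common ∣T∣≡3 (≤-reflexive ∣I∣≡3) x≢y x≢z y≢z x∈T y∈T z∈T x∈I y∈I z∈I)

    from-full : ∀ {a b c} → Full a b c → Shape
    from-full F = inj₁ ( (subst C₁ F≡I (∈C₁ F) , λ I≡T₁ → Full.≢T₁ F (trans F≡I I≡T₁))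
                       , (subst C₂ F≡I (Full.∈C₂ F) , λ I≡T₂ → Full.≢T₂ F (trans F≡I I≡T₂)) )
      where F≡I = full⇒≡I ∣I∣≡3 F

    shape : Cover x y → Cover x z → Cover y z → Shape
    shape (full F)  _         _         = from-full F
    shape _         (full F)  _         = from-full F
    shape _         _         (full F)  = from-full F
    shape (in-T₁ x∈ y∈) (in-T₁ _ z∈) _  = inj₂ (inj₁ (I≡ 𝔸₁.∣T∣≡3 x∈ y∈ z∈))
    shape (in-T₂ x∈ y∈) (in-T₂ _ z∈) _  = inj₂ (inj₂ (I≡ 𝔸₂.∣T∣≡3 x∈ y∈ z∈))
    shape (in-T₁ x∈ y∈) (in-T₂ _ _) (in-T₁ _ z∈) = inj₂ (inj₁ (I≡ 𝔸₁.∣T∣≡3 x∈ y∈ z∈))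
    shape (in-T₁ _ _) (in-T₂ x∈ z∈) (in-T₂ y∈ _) = inj₂ (inj₂ (I≡ 𝔸₂.∣T∣≡3 x∈ y∈ z∈))
    shape (in-T₂ x∈ y∈) (in-T₁ _ _) (in-T₂ _ z∈) = inj₂ (inj₂ (I≡ 𝔸₂.∣T∣≡3 x∈ y∈ z∈))
    shape (in-T₂ _ _) (in-T₁ x∈ z∈) (in-T₁ y∈ _) = inj₂ (inj₁ (I≡ 𝔸₁.∣T∣≡3 x∈ y∈ z∈))

  ∣I∣≡3⇒shape : ∣ I ∣ ≡ 3 → Shape
  ∣I∣≡3⇒shape ∣I∣≡3 with distinct-elements I 3 (≤-reflexive (sym ∣I∣≡3))
  ... | _ ∷ _ ∷ _ ∷ [] , refl , (x≢y ∷ x≢z ∷ []) ∷ (y≢z ∷ []) ∷ [] ∷ [] , x∈I ∷ y∈I ∷ z∈I ∷ [] =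
    Three.shape ∣I∣≡3 x≢y x≢z y≢z x∈I y∈I z∈I (cover x∈I y∈I x≢y) (cover x∈I z∈I x≢z) (cover y∈I z∈I y≢z)

module SmallIntersection {v} {B : Collection v} (B-STS : IsSTS v B) {D₁ C₁ T₁ D₂ C₂ T₂}
                         (A₁ : AlmostSubSTS9 B D₁ C₁ T₁) (A₂ : AlmostSubSTS9 B D₂ C₂ T₂) where
  open TwoAlmostSubSTS9 B-STS A₁ A₂
  module Swapped = TwoAlmostSubSTS9 B-STS A₂ A₁

  -- If neither T₁ nor T₂ contains I = {a, b}, the full line through a and b adds a third point to I.
  two-points : ∀ {a b} → a ≢ b → a ∈ I → b ∈ I → (∀ {x} → x ∈ I → x ≡ a ⊎ x ≡ b) →
               13 ≤ ∣ ∁ D₁ ∣ ⊎ 13 ≤ ∣ ∁ D₂ ∣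
  two-points {a} {b} a≢b a∈I b∈I I⊆ab with a ∈? T₂ ×-dec b ∈? T₂ | a ∈? T₁ ×-dec b ∈? T₁
  ... | yes (a∈T₂ , b∈T₂) | _                  = inj₁ (I⊆T₂⇒13≤∣∁D₁∣ a≢b a∈T₂ b∈T₂ I⊆ab)
  ... | no _              | yes (a∈T₁ , b∈T₁)  =
    inj₂ (Swapped.I⊆T₂⇒13≤∣∁D₁∣ a≢b a∈T₁ b∈T₁ (I⊆ab ∘ λ x∈ → ∈I (Swapped.I⊆D₂ x∈) (Swapped.I⊆D₁ x∈)))
  ... | no ¬T₂            | no ¬T₁ with full-line a∈I b∈I a≢b ¬T₁ ¬T₂
  ...   | _ , F with I⊆ab (⊆I F (z∈ F))
  ...     | inj₁ c≡a = ⊥-elim (Full.x≢z F (sym c≡a))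
  ...     | inj₂ c≡b = ⊥-elim (Full.y≢z F (sym c≡b))

  ∣I∣≡2⇒13≤∣∁D∣ : ∣ I ∣ ≡ 2 → 13 ≤ ∣ ∁ D₁ ∣ ⊎ 13 ≤ ∣ ∁ D₂ ∣
  ∣I∣≡2⇒13≤∣∁D∣ ∣I∣≡2 with distinct-elements I 2 (≤-reflexive (sym ∣I∣≡2))
  ... | _ ∷ _ ∷ [] , refl , (a≢b ∷ []) ∷ [] ∷ [] , a∈I ∷ b∈I ∷ [] =
    two-points a≢b a∈I b∈I (∈-pair a≢b a∈I b∈I (≤-reflexive ∣I∣≡2))

  ∣I∣<3⇒13≤∣∁D∣ : ∣ I ∣ < 3 → 13 ≤ ∣ ∁ D₁ ∣ ⊎ 13 ≤ ∣ ∁ D₂ ∣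
  ∣I∣<3⇒13≤∣∁D∣ (s≤s ∣I∣≤2) with ∣ I ∣ ≟ 2
  ... | yes ∣I∣≡2 = ∣I∣≡2⇒13≤∣∁D∣ ∣I∣≡2
  ... | no  ∣I∣≢2 = inj₁ (∣I∣≤1⇒13≤∣∁D₁∣ (≤-pred (≤∧≢⇒< ∣I∣≤2 ∣I∣≢2)))

  intersection-shape : D₁ ≢ D₂ → ∣ I ∣ ≡ 3 × Shape ⊎ 13 ≤ ∣ ∁ D₁ ∣ ⊎ 13 ≤ ∣ ∁ D₂ ∣
  intersection-shape D₁≢D₂ with ∣ I ∣ ≟ 3
  ... | yes ∣I∣≡3 = inj₁ (∣I∣≡3 , ∣I∣≡3⇒shape ∣I∣≡3)
  ... | no  ∣I∣≢3 = inj₂ (∣I∣<3⇒13≤∣∁D∣ (≤∧≢⇒< (∣I∣≤3 D₁≢D₂) ∣I∣≢3))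

¬13≤∣∁D∣ : ∀ (D : Subset 21) → ∣ D ∣ ≡ 9 → ¬ (13 ≤ ∣ ∁ D ∣)
¬13≤∣∁D∣ D ∣D∣≡9 = 1+n≰n ∘ subst (13 ≤_) (trans (∣∁p∣≡n∸∣p∣ D) (cong (21 ∸_) ∣D∣≡9))

corollary1 : (∀ (v : ℕ) (B : Collection v) → IsSTS v B →
    ∀ (D₁ : Subset v) (C₁ : Collection v) (T₁ : Subset v)
    (D₂ : Subset v) (C₂ : Collection v) (T₂ : Subset v) →
    AlmostSubSTS9 B D₁ C₁ T₁ → AlmostSubSTS9 B D₂ C₂ T₂ →
    D₁ ≢ D₂ → ∣ D₁ ∩ D₂ ∣ ≤ 3)
    ×
    (∀ (B : Collection 21) → IsSTS 21 B →
    ∀ (D₁ : Subset 21) (C₁ : Collection 21) (T₁ : Subset 21)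
    (D₂ : Subset 21) (C₂ : Collection 21) (T₂ : Subset 21) →
    AlmostSubSTS9 B D₁ C₁ T₁ → AlmostSubSTS9 B D₂ C₂ T₂ →
    D₁ ≢ D₂ →
    ∣ D₁ ∩ D₂ ∣ ≡ 3
    × ((Remove C₁ T₁ (D₁ ∩ D₂) × Remove C₂ T₂ (D₁ ∩ D₂))
    ⊎ (D₁ ∩ D₂ ≡ T₁ ⊎ D₁ ∩ D₂ ≡ T₂)))
corollary1 =
    (λ _ _ B-STS _ _ _ _ _ _ A₁ A₂ → TwoAlmostSubSTS9.∣I∣≤3 B-STS A₁ A₂)
  , λ _ B-STS D₁ _ _ D₂ _ _ A₁ A₂ D₁≢D₂ →
      [ id , ⊥-elim ∘ [ ¬13≤∣∁D∣ D₁ (AlmostSubSTS9.support-size A₁)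
                      , ¬13≤∣∁D∣ D₂ (AlmostSubSTS9.support-size A₂) ]′ ]′
        (SmallIntersection.intersection-shape B-STS A₁ A₂ D₁≢D₂)
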